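{- Let $p$ be an odd prime and let $(G,\boldsymbol{\gamma})$ be a $\mathbb{Z}/p\mathbb{Z}$-colored graph. Let $(H,\boldsymbol{\gamma})$ be obtained from $(G,\boldsymbol{\gamma})$ by an \textbf{(H1c)} move that adds a new vertex $n$ and edges $an$, $bn$ with colors $\gamma_{an},\gamma_{bn}$. Then the symmetric lift $\tilde H$ is obtained from the symmetric lift $\tilde G$ by applying $p$ uncolored \textbf{(H1)} moves.
   Context: A $\mathbb{Z}/p\mathbb{Z}$-colored graph is a finite directed multigraph $G=(V,E)$ with a color $\gamma_e\in\mathbb{Z}/p\mathbb{Z}$ on each edge. The symmetric lift $\tilde G$ is the undirected multigraph with vertices $\tilde i_\delta$ ($i\in V$, $\delta\in\mathbb{Z}/p\mathbb{Z}$). For each directed edge $ij$ of color $\gamma_{ij}$ and each $\delta$, it has an edge $\tilde i_\delta\tilde j_{\delta+\gamma_{ij}}$. The \textbf{(H1c)} move adds a new vertex $n$ and two edges $an$, $bn$ oriented into $n$ from existing vertices $a,b$, with arbitrary colors, except that if $a=b$ the colors must differ. An uncolored \textbf{(H1)} move on an undirected graph adds a new vertex together with two edges joining it to existing vertices. -}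

module Defs where

open import Data.Nat using (ℕ; zero; suc; _*_)
open import Data.Nat.DivMod using (_%_; m%n<n)
open import Data.Fin using (Fin; zero; suc; toℕ; fromℕ<; fromℕ; inject₁; combine; remQuot)
open import Data.Product using (_×_; _,_; Σ; ∃; ∃-syntax; proj₁; proj₂)
open import Data.Sum using (_⊎_)
open import Relation.Binary.PropositionalEquality using (_≡_)
open import Relation.Nullary using (¬_)
open import Function.Bundles using (_↔_; Inverse)

_+ₚ_ : ∀ {p} → Fin p → Fin p → Fin p
_+ₚ_ {suc q} a b = fromℕ< (m%n<n (toℕ a Data.Nat.+ toℕ b) (suc q))

record ColGraph (p : ℕ) : Set where
  field
    nV  : ℕ
    nE  : ℕ
    src : Fin nE → Fin nV
    tgt : Fin nE → Fin nV
    col : Fin nE → Fin p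
open ColGraph public

-- A finite undirected multigraph: each edge has two (unordered) endpoints,
-- stored as a pair whose order is irrelevant (see isomorphism below).
record UGraph : Set where
  field
    uV   : ℕ
    uE   : ℕ
    ends : Fin uE → Fin uV × Fin uV
open UGraph public

SameEnds : ∀ {n} → Fin n × Fin n → Fin n × Fin n → Set
SameEnds (x , y) (x' , y') = (x ≡ x' × y ≡ y') ⊎ (x ≡ y' × y ≡ x')

record UIso (K L : UGraph) : Set where
  field
    vmap : Fin (uV K) ↔ Fin (uV L)
    emap : Fin (uE K) ↔ Fin (uE L)
    compat : ∀ e →
      SameEnds (Inverse.to vmap (proj₁ (ends K e)) , Inverse.to vmap (proj₂ (ends K e)))
               (ends L (Inverse.to emap e))

-- Symmetric lift: vertex ĩ_δ is  combine i δ,  edge (e, δ) is  combine e δ,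
-- joining ĩ_δ (i = src e) and j̃_{δ+γ_e} (j = tgt e).
lift : ∀ {p} → ColGraph p → UGraph
lift {p} G = record
  { uV = nV G * p
  ; uE = nE G * p
  ; ends = λ ed → let e = proj₁ (remQuot {nE G} p ed) ; δ = proj₂ (remQuot {nE G} p ed) in
      combine (src G e) δ , combine (tgt G e) (δ +ₚ col G e)
  }

-- (H1c) move: new vertex n (= fromℕ (nV G)), edges a→n of color ca and b→n of
-- color cb (edge indices 0 and 1); old edges are shifted.
H1c : ∀ {p} (G : ColGraph p) (a b : Fin (nV G)) (ca cb : Fin p) → ColGraph p
H1c {p} G a b ca cb = record
  { nV = suc (nV G)
  ; nE = suc (suc (nE G))
  ; src = λ { zero → inject₁ a ; (suc zero) → inject₁ b ; (suc (suc e)) → inject₁ (src G e) }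
  ; tgt = λ { zero → fromℕ (nV G) ; (suc zero) → fromℕ (nV G) ; (suc (suc e)) → inject₁ (tgt G e) }
  ; col = λ { zero → ca ; (suc zero) → cb ; (suc (suc e)) → col G e }
  }

H1cAdmissible : ∀ {p} (G : ColGraph p) (a b : Fin (nV G)) (ca cb : Fin p) → Set
H1cAdmissible G a b ca cb = a ≡ b → ¬ (ca ≡ cb)

H1 : (K : UGraph) (u w : Fin (uV K)) → UGraph
H1 K u w = record
  { uV = suc (uV K)
  ; uE = suc (suc (uE K))
  ; ends = λ { zero → fromℕ (uV K) , inject₁ u
             ; (suc zero) → fromℕ (uV K) , inject₁ w
             ; (suc (suc e)) → inject₁ (proj₁ (ends K e)) , inject₁ (proj₂ (ends K e)) }
  }

data H1Steps : ℕ → UGraph → UGraph → Set where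
  done : ∀ {K L} → UIso K L → H1Steps zero K L
  step : ∀ {k K L} (u w : Fin (uV K)) → H1Steps k (H1 K u w) L → H1Steps (suc k) K L

-- A vertex of the lift is a pair (i, δ) and an edge a pair (e, δ). The (H1c) move adds the p
-- vertices ñ_δ and the 2p edges ã_{δ-γ_an} ñ_δ and b̃_{δ-γ_bn} ñ_δ, so ñ_δ has exactly two
-- neighbours in the lift of G and adding the ñ_δ one at a time is a sequence of p (H1) moves.
module Submission where

open import Defs
open import Data.Nat using (ℕ; zero; suc; _+_; _*_; _∸_; _%_; _<_; NonZero)
open import Data.Nat.DivMod using (m%n<n; %-distribˡ-+; m%n%n≡m%n; [m+n]%n≡m%n; m<n⇒m%n≡m)
open import Data.Nat.Primality using (Prime)
open import Data.Nat.Properties using (+-assoc; m+[n∸m]≡n; m∸n+n≡m; <⇒≤)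
open import Data.Fin using (Fin; zero; suc; toℕ; fromℕ<; fromℕ; inject₁; combine; remQuot)
open import Data.Fin.Properties using (toℕ-injective; toℕ-fromℕ<; toℕ<n; remQuot-combine; *↔×)
open import Data.Product using (_×_; _,_; map)
open import Data.Sum using (_⊎_; inj₁; inj₂; map₁; map₂; fromInj₁; [_,_])
open import Data.Sum.Function.Propositional using (_⊎-↔_)
open import Data.Bool using (Bool; true; false)
open import Data.Unit using (⊤; tt)
open import Function using (_∘_)
open import Function.Bundles using (_↔_; Inverse; mk↔ₛ′)
open import Function.Properties.Inverse using (↔-refl; ↔-sym; ↔-trans)
open import Relation.Binary.PropositionalEquality
  using (_≡_; refl; sym; trans; cong; cong₂; subst₂; module ≡-Reasoning)
open import Relation.Nullary using (¬_)
import Relation.Binary.Reasoning.Base.Single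

open Inverse using (to; from; strictlyInverseˡ; strictlyInverseʳ)

_-ₚ_ : ∀ {p} → Fin p → Fin p → Fin p
_-ₚ_ {suc q} a c = fromℕ< (m%n<n (toℕ a + (suc q ∸ toℕ c)) (suc q))

[m%d+n]%d≡[m+n]%d : ∀ m n d .{{_ : NonZero d}} → (m % d + n) % d ≡ (m + n) % d
[m%d+n]%d≡[m+n]%d m n d = begin
  (m % d + n) % d         ≡⟨ %-distribˡ-+ (m % d) n d ⟩
  (m % d % d + n % d) % d ≡⟨ cong (λ x → (x + n % d) % d) (m%n%n≡m%n m d) ⟩
  (m % d + n % d) % d     ≡⟨ %-distribˡ-+ m n d ⟨
  (m + n) % d             ∎
  where open ≡-Reasoning

[[m+u]%d+v]%d≡m : ∀ {m u v d} .{{_ : NonZero d}} → m < d → u + v ≡ d → ((m + u) % d + v) % d ≡ m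
[[m+u]%d+v]%d≡m {m} {u} {v} {d} m<d u+v≡d = begin
  ((m + u) % d + v) % d ≡⟨ [m%d+n]%d≡[m+n]%d (m + u) v d ⟩
  (m + u + v) % d       ≡⟨ cong (_% d) (+-assoc m u v) ⟩
  (m + (u + v)) % d     ≡⟨ cong (λ x → (m + x) % d) u+v≡d ⟩
  (m + d) % d           ≡⟨ [m+n]%n≡m%n m d ⟩
  m % d                 ≡⟨ m<n⇒m%n≡m m<d ⟩
  m                     ∎
  where open ≡-Reasoning

toℕ-+ₚ : ∀ {q} (a c : Fin (suc q)) → toℕ (a +ₚ c) ≡ (toℕ a + toℕ c) % suc q
toℕ-+ₚ {q} a c = toℕ-fromℕ< (m%n<n (toℕ a + toℕ c) (suc q))

toℕ--ₚ : ∀ {q} (a c : Fin (suc q)) → toℕ (a -ₚ c) ≡ (toℕ a + (suc q ∸ toℕ c)) % suc q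
toℕ--ₚ {q} a c = toℕ-fromℕ< (m%n<n (toℕ a + (suc q ∸ toℕ c)) (suc q))

-ₚ+ₚ-cancel : ∀ {p} (a c : Fin p) → (a -ₚ c) +ₚ c ≡ a
-ₚ+ₚ-cancel {suc q} a c = toℕ-injective (begin
  toℕ ((a -ₚ c) +ₚ c)                                 ≡⟨ toℕ-+ₚ (a -ₚ c) c ⟩
  (toℕ (a -ₚ c) + toℕ c) % suc q                      ≡⟨ cong (λ x → (x + toℕ c) % suc q) (toℕ--ₚ a c) ⟩
  ((toℕ a + (suc q ∸ toℕ c)) % suc q + toℕ c) % suc q ≡⟨ [[m+u]%d+v]%d≡m (toℕ<n a) (m∸n+n≡m (<⇒≤ (toℕ<n c))) ⟩
  toℕ a                                               ∎)
  where open ≡-Reasoning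

+ₚ-ₚ-cancel : ∀ {p} (a c : Fin p) → (a +ₚ c) -ₚ c ≡ a
+ₚ-ₚ-cancel {suc q} a c = toℕ-injective (begin
  toℕ ((a +ₚ c) -ₚ c)                                 ≡⟨ toℕ--ₚ (a +ₚ c) c ⟩
  (toℕ (a +ₚ c) + (suc q ∸ toℕ c)) % suc q            ≡⟨ cong (λ x → (x + (suc q ∸ toℕ c)) % suc q) (toℕ-+ₚ a c) ⟩
  ((toℕ a + toℕ c) % suc q + (suc q ∸ toℕ c)) % suc q ≡⟨ [[m+u]%d+v]%d≡m (toℕ<n a) (m+[n∸m]≡n (<⇒≤ (toℕ<n c))) ⟩
  toℕ a                                               ∎)
  where open ≡-Reasoning

splitLast : ∀ {n} → Fin (suc n) → Fin n ⊎ ⊤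
splitLast {zero}  zero    = inj₂ tt
splitLast {suc n} zero    = inj₁ zero
splitLast {suc n} (suc j) = map₁ suc (splitLast j)

joinLast : ∀ {n} → Fin n ⊎ ⊤ → Fin (suc n)
joinLast     (inj₁ i) = inject₁ i
joinLast {n} (inj₂ _) = fromℕ n

splitLast-inject₁ : ∀ {n} (i : Fin n) → splitLast (inject₁ i) ≡ inj₁ i
splitLast-inject₁ {suc n} zero    = refl
splitLast-inject₁ {suc n} (suc i) = cong (map₁ suc) (splitLast-inject₁ i)

splitLast-fromℕ : ∀ n → splitLast (fromℕ n) ≡ inj₂ tt
splitLast-fromℕ zero    = refl
splitLast-fromℕ (suc n) = cong (map₁ suc) (splitLast-fromℕ n)

joinLast-map₁-suc : ∀ {n} (s : Fin n ⊎ ⊤) → joinLast (map₁ suc s) ≡ suc (joinLast s)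
joinLast-map₁-suc (inj₁ i)  = refl
joinLast-map₁-suc (inj₂ tt) = refl

joinLast-splitLast : ∀ {n} (j : Fin (suc n)) → joinLast (splitLast j) ≡ j
joinLast-splitLast {zero}  zero    = refl
joinLast-splitLast {suc n} zero    = refl
joinLast-splitLast {suc n} (suc j) = trans (joinLast-map₁-suc (splitLast j)) (cong suc (joinLast-splitLast j))

splitLast-joinLast : ∀ {n} (s : Fin n ⊎ ⊤) → splitLast (joinLast s) ≡ s
splitLast-joinLast (inj₁ i)  = splitLast-inject₁ i
splitLast-joinLast (inj₂ tt) = splitLast-fromℕ _

_≈ᵤ_ : ∀ {A : Set} → A × A → A × A → Set
(x , y) ≈ᵤ (x′ , y′) = (x ≡ x′ × y ≡ y′) ⊎ (x ≡ y′ × y ≡ x′)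

≈ᵤ-refl : ∀ {A : Set} {q : A × A} → q ≈ᵤ q
≈ᵤ-refl = inj₁ (refl , refl)

≈ᵤ-sym : ∀ {A : Set} {q r : A × A} → q ≈ᵤ r → r ≈ᵤ q
≈ᵤ-sym (inj₁ (eq₁ , eq₂)) = inj₁ (sym eq₁ , sym eq₂)
≈ᵤ-sym (inj₂ (eq₁ , eq₂)) = inj₂ (sym eq₂ , sym eq₁)

≈ᵤ-trans : ∀ {A : Set} {q r s : A × A} → q ≈ᵤ r → r ≈ᵤ s → q ≈ᵤ s
≈ᵤ-trans (inj₁ (a₁ , a₂)) (inj₁ (b₁ , b₂)) = inj₁ (trans a₁ b₁ , trans a₂ b₂)
≈ᵤ-trans (inj₁ (a₁ , a₂)) (inj₂ (b₁ , b₂)) = inj₂ (trans a₁ b₁ , trans a₂ b₂)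
≈ᵤ-trans (inj₂ (a₁ , a₂)) (inj₁ (b₁ , b₂)) = inj₂ (trans a₁ b₂ , trans a₂ b₁)
≈ᵤ-trans (inj₂ (a₁ , a₂)) (inj₂ (b₁ , b₂)) = inj₁ (trans a₁ b₂ , trans a₂ b₁)

both : ∀ {A B : Set} → (A → B) → A × A → B × B
both f = map f f

≈ᵤ-both : ∀ {A B : Set} (f : A → B) {q r : A × A} → q ≈ᵤ r → both f q ≈ᵤ both f r
≈ᵤ-both f (inj₁ (eq₁ , eq₂)) = inj₁ (cong f eq₁ , cong f eq₂)
≈ᵤ-both f (inj₂ (eq₁ , eq₂)) = inj₂ (cong f eq₁ , cong f eq₂)

record Graph : Set₁ where
  field
    Vertex    : Set
    Edge      : Set
    endpoints : Edge → Vertex × Vertex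
open Graph

record _≅_ (K L : Graph) : Set where
  field
    vertices : Vertex K ↔ Vertex L
    edges    : Edge K ↔ Edge L
    endpoints-compat : ∀ e → both (to vertices) (endpoints K e) ≈ᵤ endpoints L (to edges e)
open _≅_

≅-refl : ∀ {K} → K ≅ K
≅-refl = record { vertices = ↔-refl ; edges = ↔-refl ; endpoints-compat = λ _ → ≈ᵤ-refl }

≅-sym : ∀ {K L} → K ≅ L → L ≅ K
≅-sym {K} {L} φ = record
  { vertices = ↔-sym (vertices φ)
  ; edges    = ↔-sym (edges φ)
  ; endpoints-compat = λ e → ≈ᵤ-sym (subst₂ _≈ᵤ_
      (cong₂ _,_ (strictlyInverseʳ (vertices φ) _) (strictlyInverseʳ (vertices φ) _))
      (cong (both (from (vertices φ)) ∘ endpoints L) (strictlyInverseˡ (edges φ) e))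
      (≈ᵤ-both (from (vertices φ)) (endpoints-compat φ (from (edges φ) e))))
  }

≅-trans : ∀ {K L M} → K ≅ L → L ≅ M → K ≅ M
≅-trans φ ψ = record
  { vertices = ↔-trans (vertices φ) (vertices ψ)
  ; edges    = ↔-trans (edges φ) (edges ψ)
  ; endpoints-compat = λ e →
      ≈ᵤ-trans (≈ᵤ-both (to (vertices ψ)) (endpoints-compat φ e)) (endpoints-compat ψ (to (edges φ) e))
  }

module ≅-Reasoning = Relation.Binary.Reasoning.Base.Single _≅_ ≅-refl ≅-trans

toGraph : UGraph → Graph
toGraph K = record { Vertex = Fin (uV K) ; Edge = Fin (uE K) ; endpoints = ends K }

≅⇒UIso : ∀ {K L} → toGraph K ≅ toGraph L → UIso K L
≅⇒UIso φ = record { vmap = vertices φ ; emap = edges φ ; compat = endpoints-compat φ }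

-- iterH1 up to isomorphism, without the nested re-indexing of vertices and edges.
attach : (K : Graph) (k : ℕ) (f g : Fin k → Vertex K) → Graph
attach K k f g = record
  { Vertex    = Vertex K ⊎ Fin k
  ; Edge      = Edge K ⊎ (Fin k × Bool)
  ; endpoints = λ { (inj₁ e)           → both inj₁ (endpoints K e)
                  ; (inj₂ (i , false)) → inj₂ i , inj₁ (f i)
                  ; (inj₂ (i , true))  → inj₂ i , inj₁ (g i) }
  }

attach-cong : ∀ {K L k} {f g : Fin k → Vertex K} {f′ g′ : Fin k → Vertex L} (φ : K ≅ L) →
  (∀ i → to (vertices φ) (f i) ≡ f′ i) → (∀ i → to (vertices φ) (g i) ≡ g′ i) →
  attach K k f g ≅ attach L k f′ g′
attach-cong φ f≡f′ g≡g′ = record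
  { vertices = vertices φ ⊎-↔ ↔-refl
  ; edges    = edges φ ⊎-↔ ↔-refl
  ; endpoints-compat = λ
      { (inj₁ e)           → ≈ᵤ-both inj₁ (endpoints-compat φ e)
      ; (inj₂ (i , false)) → inj₁ (refl , cong inj₁ (f≡f′ i))
      ; (inj₂ (i , true))  → inj₁ (refl , cong inj₁ (g≡g′ i)) }
  }

attach-zero : ∀ K (f g : Fin 0 → Vertex K) → K ≅ attach K 0 f g
attach-zero K f g = record
  { vertices = mk↔ₛ′ inj₁ (fromInj₁ λ ()) (λ { (inj₁ _) → refl ; (inj₂ ()) }) (λ _ → refl)
  ; edges    = mk↔ₛ′ inj₁ (fromInj₁ λ { (() , _) }) (λ { (inj₁ _) → refl ; (inj₂ (() , _)) }) (λ _ → refl)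
  ; endpoints-compat = λ _ → ≈ᵤ-refl
  }

module _ (K : UGraph) (k : ℕ) (f g : Fin (suc k) → Fin (uV K)) where

  private
    K′ = H1 K (f zero) (g zero)
    f′ g′ : Fin k → Fin (uV K′)
    f′ = inject₁ ∘ f ∘ suc
    g′ = inject₁ ∘ g ∘ suc

    vertex : Fin (uV K) ⊎ Fin (suc k) → Fin (uV K′) ⊎ Fin k
    vertex (inj₁ x)       = inj₁ (inject₁ x)
    vertex (inj₂ zero)    = inj₁ (fromℕ (uV K))
    vertex (inj₂ (suc i)) = inj₂ i

    vertex⁻¹ : Fin (uV K′) ⊎ Fin k → Fin (uV K) ⊎ Fin (suc k)
    vertex⁻¹ (inj₁ j) = map₂ (λ _ → zero) (splitLast j)
    vertex⁻¹ (inj₂ i) = inj₂ (suc i)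

    vertex-map₂ : ∀ s → vertex (map₂ (λ _ → zero) s) ≡ inj₁ (joinLast s)
    vertex-map₂ (inj₁ x)  = refl
    vertex-map₂ (inj₂ tt) = refl

    vertex-vertex⁻¹ : ∀ y → vertex (vertex⁻¹ y) ≡ y
    vertex-vertex⁻¹ (inj₁ j) = trans (vertex-map₂ (splitLast j)) (cong inj₁ (joinLast-splitLast j))
    vertex-vertex⁻¹ (inj₂ i) = refl

    vertex⁻¹-vertex : ∀ x → vertex⁻¹ (vertex x) ≡ x
    vertex⁻¹-vertex (inj₁ x)       = cong (map₂ (λ _ → zero)) (splitLast-inject₁ x)
    vertex⁻¹-vertex (inj₂ zero)    = cong (map₂ (λ _ → zero)) (splitLast-fromℕ (uV K))
    vertex⁻¹-vertex (inj₂ (suc i)) = refl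

    edge : Fin (uE K) ⊎ (Fin (suc k) × Bool) → Fin (uE K′) ⊎ (Fin k × Bool)
    edge (inj₁ e)              = inj₁ (suc (suc e))
    edge (inj₂ (zero , false)) = inj₁ zero
    edge (inj₂ (zero , true))  = inj₁ (suc zero)
    edge (inj₂ (suc i , b))    = inj₂ (i , b)

    edge⁻¹ : Fin (uE K′) ⊎ (Fin k × Bool) → Fin (uE K) ⊎ (Fin (suc k) × Bool)
    edge⁻¹ (inj₁ zero)          = inj₂ (zero , false)
    edge⁻¹ (inj₁ (suc zero))    = inj₂ (zero , true)
    edge⁻¹ (inj₁ (suc (suc e))) = inj₁ e
    edge⁻¹ (inj₂ (i , b))       = inj₂ (suc i , b)

    edge-edge⁻¹ : ∀ y → edge (edge⁻¹ y) ≡ y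
    edge-edge⁻¹ (inj₁ zero)          = refl
    edge-edge⁻¹ (inj₁ (suc zero))    = refl
    edge-edge⁻¹ (inj₁ (suc (suc e))) = refl
    edge-edge⁻¹ (inj₂ (i , b))       = refl

    edge⁻¹-edge : ∀ x → edge⁻¹ (edge x) ≡ x
    edge⁻¹-edge (inj₁ e)              = refl
    edge⁻¹-edge (inj₂ (zero , false)) = refl
    edge⁻¹-edge (inj₂ (zero , true))  = refl
    edge⁻¹-edge (inj₂ (suc i , b))    = refl

    compat : ∀ e → both vertex (endpoints (attach (toGraph K) (suc k) f g) e)
                   ≈ᵤ endpoints (attach (toGraph K′) k f′ g′) (edge e)
    compat (inj₁ e)               = ≈ᵤ-refl
    compat (inj₂ (zero , false))  = ≈ᵤ-refl
    compat (inj₂ (zero , true))   = ≈ᵤ-refl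
    compat (inj₂ (suc i , false)) = ≈ᵤ-refl
    compat (inj₂ (suc i , true))  = ≈ᵤ-refl

  attach-suc : attach (toGraph K) (suc k) f g ≅ attach (toGraph K′) k f′ g′
  attach-suc = record
    { vertices = mk↔ₛ′ vertex vertex⁻¹ vertex-vertex⁻¹ vertex⁻¹-vertex
    ; edges    = mk↔ₛ′ edge edge⁻¹ edge-edge⁻¹ edge⁻¹-edge
    ; endpoints-compat = compat
    }

iterH1 : (K : UGraph) (k : ℕ) (f g : Fin k → Fin (uV K)) → UGraph
iterH1 K zero    f g = K
iterH1 K (suc k) f g = iterH1 (H1 K (f zero) (g zero)) k (inject₁ ∘ f ∘ suc) (inject₁ ∘ g ∘ suc)

H1Steps-iterH1 : ∀ {L} K k (f g : Fin k → Fin (uV K)) → UIso (iterH1 K k f g) L → H1Steps k K L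
H1Steps-iterH1 K zero    f g φ = done φ
H1Steps-iterH1 K (suc k) f g φ = step (f zero) (g zero) (H1Steps-iterH1 _ k _ _ φ)

iterH1≅attach : ∀ K k (f g : Fin k → Fin (uV K)) → toGraph (iterH1 K k f g) ≅ attach (toGraph K) k f g
iterH1≅attach K zero    f g = attach-zero (toGraph K) f g
iterH1≅attach K (suc k) f g = ≅-trans (iterH1≅attach _ k _ _) (≅-sym (attach-suc K k f g))

liftGraph : ∀ {p} → ColGraph p → Graph
liftGraph {p} G = record
  { Vertex    = Fin (nV G) × Fin p
  ; Edge      = Fin (nE G) × Fin p
  ; endpoints = λ (e , δ) → (src G e , δ) , (tgt G e , δ +ₚ col G e)
  }

lift≅liftGraph : ∀ {p} (G : ColGraph p) → toGraph (lift G) ≅ liftGraph G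
lift≅liftGraph {p} G = record
  { vertices = *↔×
  ; edges    = *↔×
  ; endpoints-compat = λ x → let (e , δ) = remQuot {nE G} p x in
      inj₁ (remQuot-combine (src G e) δ , remQuot-combine (tgt G e) (δ +ₚ col G e))
  }

module _ {p} (G : ColGraph p) (a b : Fin (nV G)) (ca cb : Fin p) where

  private
    H = H1c G a b ca cb

    vertex : (Fin (nV G) × Fin p) ⊎ Fin p → Fin (suc (nV G)) × Fin p
    vertex (inj₁ (i , δ)) = inject₁ i , δ
    vertex (inj₂ δ)       = fromℕ (nV G) , δ

    unsplit : Fin p → Fin (nV G) ⊎ ⊤ → (Fin (nV G) × Fin p) ⊎ Fin p
    unsplit δ = [ (λ i → inj₁ (i , δ)) , (λ _ → inj₂ δ) ]

    vertex⁻¹ : Fin (suc (nV G)) × Fin p → (Fin (nV G) × Fin p) ⊎ Fin p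
    vertex⁻¹ (j , δ) = unsplit δ (splitLast j)

    vertex-unsplit : ∀ δ s → vertex (unsplit δ s) ≡ (joinLast s , δ)
    vertex-unsplit δ (inj₁ i)  = refl
    vertex-unsplit δ (inj₂ tt) = refl

    vertex-vertex⁻¹ : ∀ y → vertex (vertex⁻¹ y) ≡ y
    vertex-vertex⁻¹ (j , δ) = trans (vertex-unsplit δ (splitLast j)) (cong (_, δ) (joinLast-splitLast j))

    vertex⁻¹-vertex : ∀ x → vertex⁻¹ (vertex x) ≡ x
    vertex⁻¹-vertex (inj₁ (i , δ)) = cong (unsplit δ) (splitLast-inject₁ i)
    vertex⁻¹-vertex (inj₂ δ)       = cong (unsplit δ) (splitLast-fromℕ (nV G))

    edge : (Fin (nE G) × Fin p) ⊎ (Fin p × Bool) → Fin (suc (suc (nE G))) × Fin p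
    edge (inj₁ (e , δ))     = suc (suc e) , δ
    edge (inj₂ (δ , false)) = zero , δ -ₚ ca
    edge (inj₂ (δ , true))  = suc zero , δ -ₚ cb

    edge⁻¹ : Fin (suc (suc (nE G))) × Fin p → (Fin (nE G) × Fin p) ⊎ (Fin p × Bool)
    edge⁻¹ (zero , δ)        = inj₂ (δ +ₚ ca , false)
    edge⁻¹ (suc zero , δ)    = inj₂ (δ +ₚ cb , true)
    edge⁻¹ (suc (suc e) , δ) = inj₁ (e , δ)

    edge-edge⁻¹ : ∀ y → edge (edge⁻¹ y) ≡ y
    edge-edge⁻¹ (zero , δ)        = cong (zero ,_) (+ₚ-ₚ-cancel δ ca)
    edge-edge⁻¹ (suc zero , δ)    = cong (suc zero ,_) (+ₚ-ₚ-cancel δ cb)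
    edge-edge⁻¹ (suc (suc e) , δ) = refl

    edge⁻¹-edge : ∀ x → edge⁻¹ (edge x) ≡ x
    edge⁻¹-edge (inj₁ (e , δ))     = refl
    edge⁻¹-edge (inj₂ (δ , false)) = cong (λ δ′ → inj₂ (δ′ , false)) (-ₚ+ₚ-cancel δ ca)
    edge⁻¹-edge (inj₂ (δ , true))  = cong (λ δ′ → inj₂ (δ′ , true)) (-ₚ+ₚ-cancel δ cb)

    compat : ∀ e → both vertex (endpoints (attach (liftGraph G) p (λ δ → a , δ -ₚ ca) (λ δ → b , δ -ₚ cb)) e)
                   ≈ᵤ endpoints (liftGraph H) (edge e)
    compat (inj₁ (e , δ))     = ≈ᵤ-refl
    compat (inj₂ (δ , false)) = inj₂ (cong (fromℕ (nV G) ,_) (sym (-ₚ+ₚ-cancel δ ca)) , refl)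
    compat (inj₂ (δ , true))  = inj₂ (cong (fromℕ (nV G) ,_) (sym (-ₚ+ₚ-cancel δ cb)) , refl)

  attach≅liftGraph-H1c : attach (liftGraph G) p (λ δ → a , δ -ₚ ca) (λ δ → b , δ -ₚ cb) ≅ liftGraph H
  attach≅liftGraph-H1c = record
    { vertices = mk↔ₛ′ vertex vertex⁻¹ vertex-vertex⁻¹ vertex⁻¹-vertex
    ; edges    = mk↔ₛ′ edge edge⁻¹ edge-edge⁻¹ edge⁻¹-edge
    ; endpoints-compat = compat
    }

lemma8 : (p : ℕ) → Prime p → ¬ (p ≡ 2) →
    (G : ColGraph p) (a b : Fin (nV G)) (ca cb : Fin p) →
    H1cAdmissible G a b ca cb →
    H1Steps p (lift G) (lift (H1c G a b ca cb))
lemma8 p _ _ G a b ca cb _ = H1Steps-iterH1 (lift G) p f g (≅⇒UIso (begin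
  toGraph (iterH1 (lift G) p f g)
    ∼⟨ iterH1≅attach (lift G) p f g ⟩
  attach (toGraph (lift G)) p f g
    ∼⟨ attach-cong (lift≅liftGraph G) (λ δ → remQuot-combine a (δ -ₚ ca)) (λ δ → remQuot-combine b (δ -ₚ cb)) ⟩
  attach (liftGraph G) p (λ δ → a , δ -ₚ ca) (λ δ → b , δ -ₚ cb)
    ∼⟨ attach≅liftGraph-H1c G a b ca cb ⟩
  liftGraph (H1c G a b ca cb)
    ∼⟨ ≅-sym (lift≅liftGraph (H1c G a b ca cb)) ⟩
  toGraph (lift (H1c G a b ca cb)) ∎))
  where
  open ≅-Reasoning
  f g : Fin p → Fin (nV G * p)
  f δ = combine a (δ -ₚ ca)
  g δ = combine b (δ -ₚ cb)
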